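{- Let $R$ be (the strict order relation of) a series parallel interval order on a finite set $X$, and let $\lambda_1$ and $\lambda_2$ be two preorder linear extensions of $R$. If $x,y\in X$ satisfy $\lambda_1(x)>\lambda_1(y)$ and $\lambda_2(x)<\lambda_2(y)$, then $x$ and $y$ are order equivalent in $R$.
   Context: A series parallel interval order is a finite poset having no induced subposet isomorphic to $2+2$ (the disjoint union of two 2-element chains) nor to the fence of order four (the poset $N$ on $\{a,b,c,d\}$ with $a<c$, $b<c$, $b<d$ and no other strict relations); one works with its strict order relation $R$ on the support $X$. For a binary relation $B$ write $\overline{B}=B\cup B^{ -1}$. Define the relation $Z=Z(R)$ on $X$ by: $xZy$ iff $(x,y)\notin\overline{R}$ and there exists $z\in X$ with $z\overline{R}y$ and $(z,x)\notin\overline{R}$ (i.e. $Z=((\overline{R})^c\circ\overline{R})\setminus\overline{R}$, where $x(A\circ B)y$ iff $\exists z$: $xAz$ and $zBy$). A linear extension of $R$ is a bijection $\lambda:X\to\{1,\dots,|X|\}$ with $xRy\Rightarrow\lambda(x)<\lambda(y)$; it is a preorder linear extension if moreover $xZy\Rightarrow\lambda(x)<\lambda(y)$. Two elements $x,y$ are order equivalent in $R$ if there is an order automorphism of $(X,R)$ mapping $x$ to $y$. -}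

module Defs where

open import Data.Nat using (ℕ)
open import Data.Fin using (Fin; _<_)
open import Data.Product using (Σ; ∃; _×_; _,_)
open import Data.Sum using (_⊎_)
open import Relation.Nullary using (¬_)
open import Relation.Binary.PropositionalEquality using (_≡_)
open import Function.Definitions using (Bijective)

Rel : ℕ → Set₁
Rel n = Fin n → Fin n → Set

record IsStrictOrder {n : ℕ} (R : Rel n) : Set where
  field
    irrefl : ∀ x → ¬ R x x
    trans  : ∀ {x y z} → R x y → R y z → R x z

Sym : {n : ℕ} → Rel n → Rel n
Sym R x y = R x y ⊎ R y x

-- No induced 2+2: no a<b, c<d with a,b each incomparable to c,d.
-- (For a strict order, distinctness of a,b,c,d and all other
-- non-relations are then automatic.)
No2+2 : {n : ℕ} → Rel n → Set
No2+2 R = ∀ a b c d → R a b → R c d →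
  ¬ (¬ Sym R a c × ¬ Sym R a d × ¬ Sym R b c × ¬ Sym R b d)

-- No induced fence N: a<c, b<c, b<d, and a,d incomparable, a,b
-- incomparable, c,d incomparable (the only other pairs).
NoN : {n : ℕ} → Rel n → Set
NoN R = ∀ a b c d → R a c → R b c → R b d →
  ¬ (¬ Sym R a b × ¬ Sym R a d × ¬ Sym R c d)

record IsSPIOrder {n : ℕ} (R : Rel n) : Set where
  field
    isStrictOrder : IsStrictOrder R
    no2+2 : No2+2 R
    noN   : NoN R

-- Z(R) = ((R̄)ᶜ ∘ R̄) \ R̄
Z : {n : ℕ} → Rel n → Rel n
Z R x y = ¬ Sym R x y × ∃ λ z → Sym R z y × ¬ Sym R z x

-- Linear extension: bijection λ : X → {1..|X|} (here {0..|X|-1} = Fin n)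
-- respecting R.
record IsLinearExtension {n : ℕ} (R : Rel n) (λ' : Fin n → Fin n) : Set where
  field
    bijective : Bijective _≡_ _≡_ λ'
    monotone  : ∀ {x y} → R x y → λ' x < λ' y

record IsPreorderLinearExtension {n : ℕ} (R : Rel n) (λ' : Fin n → Fin n) : Set where
  field
    linearExtension : IsLinearExtension R λ'
    respectsZ : ∀ {x y} → Z R x y → λ' x < λ' y

record IsOrderAutomorphism {n : ℕ} (R : Rel n) (σ : Fin n → Fin n) : Set where
  field
    bijective : Bijective _≡_ _≡_ σ
    preserves : ∀ {x y} → R x y → R (σ x) (σ y)
    reflects  : ∀ {x y} → R (σ x) (σ y) → R x y

OrderEquivalent : {n : ℕ} → Rel n → Fin n → Fin n → Set
OrderEquivalent {n} R x y = Σ (Fin n → Fin n) λ σ → IsOrderAutomorphism R σ × σ x ≡ y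

-- Two preorder linear extensions that disagree on x and y force x and y to be
-- incomparable, and (since each of them respects Z) to be comparable to exactly
-- the same elements.  In a strict order this means x and y have the same
-- predecessors and the same successors, so the transposition of x and y is an
-- order automorphism.
module Submission where

open import Defs
open import Data.Nat using (ℕ)
open import Data.Fin using (Fin; _<_; _>_; _≟_)
open import Data.Fin.Properties using (<-asym)
open import Data.Fin.Permutation using (transpose)
open import Data.Fin.Permutation.Components using (transpose-inverse)
import Data.Fin.Permutation.Components as Components
open import Data.Product using (_,_)
open import Data.Sum using (inj₁; inj₂; swap)
open import Function using (_∘_; _⇔_; Equivalence; mk⇔)
open import Function.Bundles using (Bijection)
open import Function.Properties.Inverse using (Inverse⇒Bijection)
import Function.Properties.Equivalence as ⇔
open import Relation.Binary using (Decidable)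
open import Relation.Nullary using (¬_; Dec; yes; no; contradiction)
open import Relation.Nullary.Decidable using (dec-true; dec-false; _⊎-dec_)
open import Relation.Binary.PropositionalEquality using (_≡_; refl; sym; subst; subst₂)

private
  variable
    n : ℕ
    R : Rel n

module _ {n : ℕ} (i j : Fin n) {k : Fin n} where

  transpose-matchˡ : k ≡ i → Components.transpose i j k ≡ j
  transpose-matchˡ k≡i rewrite dec-true (k ≟ i) k≡i = refl

  transpose-matchʳ : ¬ k ≡ i → k ≡ j → Components.transpose i j k ≡ i
  transpose-matchʳ k≢i k≡j rewrite dec-false (k ≟ i) k≢i | dec-true (k ≟ j) k≡j = refl

  transpose-other : ¬ k ≡ i → ¬ k ≡ j → Components.transpose i j k ≡ k
  transpose-other k≢i k≢j rewrite dec-false (k ≟ i) k≢i | dec-false (k ≟ j) k≢j = refl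

record Twins (R : Rel n) (x y : Fin n) : Set where
  field
    below : ∀ {z} → R z x ⇔ R z y
    above : ∀ {z} → R x z ⇔ R y z

open Twins

twins-refl : ∀ x → Twins R x x
twins-refl x = record { below = ⇔.refl ; above = ⇔.refl }

twins-sym : ∀ {x y} → Twins R x y → Twins R y x
twins-sym t = record { below = ⇔.sym (below t) ; above = ⇔.sym (above t) }

twins-transpose : ∀ {x y} → Twins R x y → ∀ k → Twins R k (Components.transpose x y k)
twins-transpose {R = R} {x} {y} t k = by-cases (k ≟ x) (k ≟ y)
  where
  by-cases : Dec (k ≡ x) → Dec (k ≡ y) → Twins R k (Components.transpose x y k)
  by-cases (yes k≡x) _ =
    subst₂ (Twins R) (sym k≡x) (sym (transpose-matchˡ x y k≡x)) t
  by-cases (no k≢x) (yes k≡y) =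
    subst₂ (Twins R) (sym k≡y) (sym (transpose-matchʳ x y k≢x k≡y)) (twins-sym t)
  by-cases (no k≢x) (no k≢y) =
    subst (Twins R k) (sym (transpose-other x y k≢x k≢y)) (twins-refl k)

transpose-preserves : ∀ {x y} → Twins R x y →
  ∀ {a b} → R a b → R (Components.transpose x y a) (Components.transpose x y b)
transpose-preserves t {a} {b} =
  Equivalence.to (below (twins-transpose t b)) ∘ Equivalence.to (above (twins-transpose t a))

transpose-isOrderAutomorphism : ∀ {x y} → Twins R x y →
  IsOrderAutomorphism R (Components.transpose x y)
transpose-isOrderAutomorphism {R = R} {x} {y} t = record
  { bijective = Bijection.bijective (Inverse⇒Bijection (transpose x y))
  ; preserves = transpose-preserves t
  ; reflects  =
      subst₂ R (transpose-inverse y x) (transpose-inverse y x)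
      ∘ transpose-preserves (twins-sym t)
  }

twins⇒orderEquivalent : ∀ {x y} → Twins R x y → OrderEquivalent R x y
twins⇒orderEquivalent {x = x} {y} t =
  Components.transpose x y , transpose-isOrderAutomorphism t , transpose-matchˡ x y refl

module _ {x y : Fin n} where

  incomparable-if-ordered-oppositely : ∀ {λ₁ λ₂} →
    IsLinearExtension R λ₁ → IsLinearExtension R λ₂ →
    λ₁ x > λ₁ y → λ₂ x < λ₂ y → ¬ Sym R x y
  incomparable-if-ordered-oppositely e₁ e₂ x>y x<y (inj₁ xRy) =
    <-asym x>y (IsLinearExtension.monotone e₁ xRy)
  incomparable-if-ordered-oppositely e₁ e₂ x>y x<y (inj₂ yRx) =
    <-asym x<y (IsLinearExtension.monotone e₂ yRx)

  comparability-transfer : ∀ {λ'} → Decidable R → IsPreorderLinearExtension R λ' →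
    λ' x > λ' y → ¬ Sym R x y → ∀ {z} → Sym R z y → Sym R z x
  comparability-transfer R? e x>y x∥y {z} zy with R? z x ⊎-dec R? x z
  ... | yes zx = zx
  ... | no z∥x = contradiction (IsPreorderLinearExtension.respectsZ e (x∥y , z , zy , z∥x)) (<-asym x>y)

  module _ (strict : IsStrictOrder R) (x∥y : ¬ Sym R x y)
           (comparable-x⇒y : ∀ {z} → Sym R z x → Sym R z y) where
    open IsStrictOrder strict

    below-transfer : ∀ {z} → R z x → R z y
    below-transfer zx with comparable-x⇒y (inj₁ zx)
    ... | inj₁ zy = zy
    ... | inj₂ yz = contradiction (inj₂ (trans yz zx)) x∥y

    above-transfer : ∀ {z} → R x z → R y z
    above-transfer xz with comparable-x⇒y (inj₂ xz)
    ... | inj₁ zy = contradiction (inj₁ (trans xz zy)) x∥y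
    ... | inj₂ yz = yz

sameComparability⇒twins : ∀ {x y} → IsStrictOrder R → ¬ Sym R x y →
  (∀ {z} → Sym R z x → Sym R z y) → (∀ {z} → Sym R z y → Sym R z x) → Twins R x y
sameComparability⇒twins strict x∥y x⇒y y⇒x = record
  { below = mk⇔ (below-transfer strict x∥y x⇒y) (below-transfer strict (x∥y ∘ swap) y⇒x)
  ; above = mk⇔ (above-transfer strict x∥y x⇒y) (above-transfer strict (x∥y ∘ swap) y⇒x)
  }

mainTheorem1 : (n : ℕ) (R : Rel n) → Decidable R → IsSPIOrder R →
    (λ₁ λ₂ : Fin n → Fin n) →
    IsPreorderLinearExtension R λ₁ → IsPreorderLinearExtension R λ₂ →
    (x y : Fin n) → λ₁ x > λ₁ y → λ₂ x < λ₂ y →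
    OrderEquivalent R x y
mainTheorem1 n R R? spi λ₁ λ₂ e₁ e₂ x y x>y x<y =
  twins⇒orderEquivalent
    (sameComparability⇒twins (IsSPIOrder.isStrictOrder spi) x∥y
      (comparability-transfer R? e₂ x<y (x∥y ∘ swap))
      (comparability-transfer R? e₁ x>y x∥y))
  where
  x∥y : ¬ Sym R x y
  x∥y = incomparable-if-ordered-oppositely
    (IsPreorderLinearExtension.linearExtension e₁)
    (IsPreorderLinearExtension.linearExtension e₂) x>y x<y
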